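{- For integers $d\ge1$, $k\ge2^{d+1}$, and $n\ge d+1$, \[f(n,k,d+1)\le \frac{n}{d+1}\,f(n-1,\lfloor k/2\rfloor,d).\]
   Context: A family $\mathcal{F}$ of subsets of $[n]$ shatters $A\subseteq[n]$ if for every $A'\subseteq A$ there is $F\in\mathcal{F}$ with $F\cap A=A'$; $f(n,k,d)$ is the maximum number of $d$-subsets of $[n]$ shattered by some $\mathcal{F}\subseteq 2^{[n]}$ with $|\mathcal{F}|\le k$. -}

module Defs where

open import Data.Nat using (ℕ; zero; suc; _≤?_; _⊔_)
open import Data.Nat.Properties using () renaming (_≟_ to _≟ℕ_)
open import Data.Bool.Properties using () renaming (_≟_ to _≟B_)
open import Data.List using (List; []; _∷_; [_]; _++_; map; filter; length; foldr)
open import Data.List.Relation.Unary.All using (All)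
open import Data.List.Relation.Unary.All as All using (all?)
open import Data.List.Relation.Unary.Any using (Any; any?)
open import Data.Vec using ([]; _∷_)
open import Data.Vec.Properties using (≡-dec)
open import Data.Fin.Subset using (Subset; inside; outside; _∩_; _⊆_; ∣_∣)
open import Data.Fin.Subset.Properties using (_⊆?_)
open import Relation.Binary.PropositionalEquality using (_≡_)
open import Relation.Nullary using (Dec)
open import Relation.Nullary.Decidable using (_→-dec_; _×-dec_)
open import Data.Product using (_×_)

allSubsets : (n : ℕ) → List (Subset n)
allSubsets zero = [ [] ]
allSubsets (suc n) = map (outside ∷_) (allSubsets n) ++ map (inside ∷_) (allSubsets n)

sublists : {A : Set} → List A → List (List A)
sublists [] = [ [] ]
sublists (x ∷ xs) = sublists xs ++ map (x ∷_) (sublists xs)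

Shatters : {n : ℕ} → List (Subset n) → Subset n → Set
Shatters {n} F A = All (λ A' → A' ⊆ A → Any (λ X → X ∩ A ≡ A') F) (allSubsets n)

shatters? : {n : ℕ} (F : List (Subset n)) (A : Subset n) → Dec (Shatters F A)
shatters? {n} F A =
  all? (λ A' → (A' ⊆? A) →-dec any? (λ X → ≡-dec _≟B_ (X ∩ A) A') F) (allSubsets n)

shatteredCount : (n : ℕ) → List (Subset n) → ℕ → ℕ
shatteredCount n F d =
  length (filter (λ A → (∣ A ∣ ≟ℕ d) ×-dec shatters? F A) (allSubsets n))

-- Families are enumerated as sublists of the
-- duplicate-free list allSubsets n, so |F| is the list length.
f : ℕ → ℕ → ℕ → ℕ
f n k d = foldr _⊔_ 0
  (map (λ F → shatteredCount n F d)
       (filter (λ F → length F ≤? k) (sublists (allSubsets n))))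

-- Double counting: (d + 1) times the number of shattered (d + 1)-sets is the sum over
-- the points i of the number of shattered (d + 1)-sets containing i.  For a fixed i,
-- one of the halves F_i^b = {X ∈ F : X_i = b} has at most ⌊k/2⌋ members, and
-- A ↦ A ∖ {i} sends the shattered (d + 1)-sets containing i injectively to d-sets
-- shattered by the trace {X ∖ {i} : X ∈ F_i^b}, a family on n - 1 points with at
-- most ⌊k/2⌋ members.  So each of the n summands is at most f(n - 1, ⌊k/2⌋, d).
module Submission where

open import Defs
open import Data.Nat using (ℕ; zero; suc; _+_; _*_; _∸_; _^_; _≤_; z≤n; _≤?_)
open import Data.Nat.Properties
open import Data.Nat.DivMod using (_/_; m*n/n≡m; /-monoˡ-≤)
open import Data.Nat.ListAction using (sum)
open import Algebra.Properties.CommutativeSemigroup +-commutativeSemigroup using (x∙yz≈y∙xz)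
open import Data.Bool using (Bool; true; false; _∧_)
open import Data.Bool.Properties using (∧-identityʳ) renaming (_≟_ to _≟B_)
open import Data.Fin using (Fin; zero; suc)
open import Data.Fin.Properties using (injective⇒≤)
open import Data.Vec using (Vec; []; _∷_; here; there; lookup; tail; zipWith; insertAt; removeAt)
open import Data.Vec.Properties
  using (∷-injectiveʳ; ≡-dec; lookup-zipWith; insertAt-lookup; removeAt-insertAt; insertAt-removeAt)
open import Data.Fin.Subset using (Subset; inside; outside; _∩_; _⊆_; ∣_∣)
open import Data.Fin.Subset.Properties using (drop-∷-⊆)
import Data.List as List
open import Data.List using (List; []; _∷_; map; filter; length)
open import Data.List.Properties using (length-map; foldr-preservesᵇ; foldr-preservesᵒ)
open import Data.List.Membership.Propositional using (_∈_; find; lose)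
open import Data.List.Membership.Propositional.Properties
  using (∈-filter⁺; ∈-filter⁻; ∈-map⁺; ∈-map⁻; ∈-++⁺ˡ; ∈-++⁺ʳ; ∈-lookup)
import Data.List.Membership.Setoid.Properties as SetoidMembership
open import Data.List.Relation.Binary.Subset.Propositional using () renaming (_⊆_ to _⊆ˡ_)
open import Data.List.Relation.Unary.Any as Any using (Any; here; any?)
import Data.List.Relation.Unary.Any.Properties as Any
open import Data.List.Relation.Unary.All as All using (All; []; _∷_)
import Data.List.Relation.Unary.All.Properties as All
open import Data.List.Relation.Unary.Unique.Propositional using (Unique)
open import Data.List.Relation.Unary.AllPairs using ([]; _∷_)
import Data.List.Relation.Unary.Unique.Propositional.Properties as Unique
open import Data.Product using (Σ; _×_; _,_; proj₁; proj₂)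
open import Data.Sum using (inj₂; [_,_]; [_,_]′)
open import Data.Empty using (⊥)
open import Function using (_∘_)
open import Relation.Nullary using (yes; no; contradiction)
open import Relation.Nullary.Decidable using (_×-dec_)
open import Relation.Unary using (Decidable)
open import Relation.Binary.PropositionalEquality
  using (_≡_; refl; sym; trans; cong; cong₂; subst; setoid; module ≡-Reasoning)

module _ {A : Set} where

  Unique⇒lookup-injective : {xs : List A} → Unique xs →
    ∀ {i j} → List.lookup xs i ≡ List.lookup xs j → i ≡ j
  Unique⇒lookup-injective (_ ∷ _) {zero} {zero} _ = refl
  Unique⇒lookup-injective (x∉xs ∷ _) {zero} {suc j} eq = contradiction eq (All.lookup x∉xs (∈-lookup j))
  Unique⇒lookup-injective (x∉xs ∷ _) {suc i} {zero} eq = contradiction (sym eq) (All.lookup x∉xs (∈-lookup i))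
  Unique⇒lookup-injective (_ ∷ xs!) {suc i} {suc j} eq = cong suc (Unique⇒lookup-injective xs! eq)

  Unique⇒length-mono-⊆ : {xs ys : List A} → Unique xs → xs ⊆ˡ ys → length xs ≤ length ys
  Unique⇒length-mono-⊆ xs! xs⊆ys = injective⇒≤ λ eq → Unique⇒lookup-injective xs!
    (SetoidMembership.index-injective (setoid A) (xs⊆ys (∈-lookup _)) (xs⊆ys (∈-lookup _)) eq)

  sum-map-const : (g : A → ℕ) {c : ℕ} (xs : List A) → All (λ x → g x ≡ c) xs →
    sum (map g xs) ≡ length xs * c
  sum-map-const g [] [] = refl
  sum-map-const g (x ∷ xs) (gx≡c ∷ gxs≡c) = cong₂ _+_ gx≡c (sum-map-const g xs gxs≡c)

  length-filter-false+true : (g : A → Bool) (xs : List A) →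
    length (filter (λ x → g x ≟B false) xs) + length (filter (λ x → g x ≟B true) xs) ≡ length xs
  length-filter-false+true g [] = refl
  length-filter-false+true g (x ∷ xs) with g x
  ... | false = cong suc (length-filter-false+true g xs)
  ... | true = trans (+-suc _ _) (cong suc (length-filter-false+true g xs))

  filter-∈-sublists : {P : A → Set} (P? : Decidable P) (xs : List A) → filter P? xs ∈ sublists xs
  filter-∈-sublists P? [] = here refl
  filter-∈-sublists P? (x ∷ xs) with P? x
  ... | yes _ = ∈-++⁺ʳ (sublists xs) (∈-map⁺ (x ∷_) (filter-∈-sublists P? xs))
  ... | no _ = ∈-++⁺ˡ (filter-∈-sublists P? xs)

≤-half : ∀ {a b k} → a ≤ b → a + b ≤ k → a ≤ k / 2
≤-half {a} {b} {k} a≤b a+b≤k = begin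
  a          ≡⟨ sym (m*n/n≡m a 2) ⟩
  a * 2 / 2  ≤⟨ /-monoˡ-≤ 2 a*2≤k ⟩
  k / 2      ∎
  where
  open ≤-Reasoning
  a*2≤k : a * 2 ≤ k
  a*2≤k = begin
    a * 2        ≡⟨ *-comm a 2 ⟩
    a + (a + 0)  ≤⟨ +-monoʳ-≤ a (≤-trans (≤-reflexive (+-identityʳ a)) a≤b) ⟩
    a + b        ≤⟨ a+b≤k ⟩
    k            ∎

allSubsets-unique : ∀ n → Unique (allSubsets n)
allSubsets-unique zero = [] ∷ []
allSubsets-unique (suc n) = Unique.++⁺
  (Unique.map⁺ ∷-injectiveʳ (allSubsets-unique n)) (Unique.map⁺ ∷-injectiveʳ (allSubsets-unique n)) disjoint
  where
  disjoint : ∀ {X} → X ∈ map (outside ∷_) (allSubsets n) × X ∈ map (inside ∷_) (allSubsets n) → ⊥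
  disjoint (X∈outs , X∈ins) with ∈-map⁻ (outside ∷_) X∈outs | ∈-map⁻ (inside ∷_) X∈ins
  ... | _ , _ , refl | _ , _ , ()

∈-allSubsets : ∀ {n} (X : Subset n) → X ∈ allSubsets n
∈-allSubsets [] = here refl
∈-allSubsets (false ∷ X) = ∈-++⁺ˡ (∈-map⁺ (outside ∷_) (∈-allSubsets X))
∈-allSubsets {suc n} (true ∷ X) =
  ∈-++⁺ʳ (map (outside ∷_) (allSubsets n)) (∈-map⁺ (inside ∷_) (∈-allSubsets X))

shatteredCount≤f : ∀ {n k d} {F : List (Subset n)} → F ∈ sublists (allSubsets n) → length F ≤ k →
  shatteredCount n F d ≤ f n k d
shatteredCount≤f {n} {k} {d} F∈ |F|≤k = foldr-preservesᵒ
  (λ x y → [ m≤n⇒m≤n⊔o y , m≤n⇒m≤o⊔n x ]) 0 _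
  (inj₂ (Any.map ≤-reflexive
    (∈-map⁺ (λ G → shatteredCount n G d) (∈-filter⁺ (λ G → length G ≤? k) F∈ |F|≤k))))

*-f≤ : ∀ {n k d} c {b} → (∀ F → length F ≤ k → c * shatteredCount n F d ≤ b) → c * f n k d ≤ b
*-f≤ {n} {k} {d} c {b} bound = foldr-preservesᵇ {P = λ x → c * x ≤ b}
  (λ {x} {y} cx≤b cy≤b → subst (_≤ b) (sym (*-distribˡ-⊔ c x y)) (⊔-lub cx≤b cy≤b))
  (≤-trans (≤-reflexive (*-zeroʳ c)) z≤n)
  (All.map⁺ (All.tabulate λ {F} F∈ →
    bound F (proj₂ (∈-filter⁻ (λ G → length G ≤? k) {xs = sublists (allSubsets n)} F∈))))

removeAt-zipWith : ∀ {A B C : Set} {n} (g : A → B → C) (xs : Vec A (suc n)) (ys : Vec B (suc n)) i →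
  removeAt (zipWith g xs ys) i ≡ zipWith g (removeAt xs i) (removeAt ys i)
removeAt-zipWith g (x ∷ xs) (y ∷ ys) zero = refl
removeAt-zipWith g (x ∷ xs@(_ ∷ _)) (y ∷ ys@(_ ∷ _)) (suc i) = cong (g x y ∷_) (removeAt-zipWith g xs ys i)

∣A∣≡1+∣removeAt∣ : ∀ {n} (A : Subset (suc n)) i → lookup A i ≡ true → ∣ A ∣ ≡ suc ∣ removeAt A i ∣
∣A∣≡1+∣removeAt∣ (true ∷ A) zero refl = refl
∣A∣≡1+∣removeAt∣ (true ∷ A@(_ ∷ _)) (suc i) Aᵢ = cong suc (∣A∣≡1+∣removeAt∣ A i Aᵢ)
∣A∣≡1+∣removeAt∣ (false ∷ A@(_ ∷ _)) (suc i) Aᵢ = ∣A∣≡1+∣removeAt∣ A i Aᵢ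

insertAt-⊆ : ∀ {n} {A : Subset (suc n)} {B : Subset n} i b →
  lookup A i ≡ true → B ⊆ removeAt A i → insertAt B i b ⊆ A
insertAt-⊆ {A = true ∷ A} zero b refl B⊆A here = here
insertAt-⊆ {A = true ∷ A} zero b refl B⊆A (there x∈B) = there (B⊆A x∈B)
insertAt-⊆ {A = a ∷ A@(_ ∷ _)} {c ∷ B} (suc i) b Aᵢ cB⊆aA here with cB⊆aA here
... | here = here
insertAt-⊆ {A = a ∷ A@(_ ∷ _)} {c ∷ B} (suc i) b Aᵢ cB⊆aA (there x∈B) =
  there (insertAt-⊆ i b Aᵢ (drop-∷-⊆ cB⊆aA) x∈B)

lookup-∩-insertAt : ∀ {n} {X A : Subset (suc n)} {B : Subset n} i b →
  lookup A i ≡ true → X ∩ A ≡ insertAt B i b → lookup X i ≡ b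
lookup-∩-insertAt {X = X} {A} {B} i b Aᵢ X∩A≡ = begin
  lookup X i                ≡⟨ sym (∧-identityʳ (lookup X i)) ⟩
  lookup X i ∧ true         ≡⟨ cong (lookup X i ∧_) (sym Aᵢ) ⟩
  lookup X i ∧ lookup A i   ≡⟨ sym (lookup-zipWith _∧_ i X A) ⟩
  lookup (X ∩ A) i          ≡⟨ cong (λ Y → lookup Y i) X∩A≡ ⟩
  lookup (insertAt B i b) i ≡⟨ insertAt-lookup B i b ⟩
  b                         ∎
  where open ≡-Reasoning

withCoord : ∀ {n} → Fin n → Bool → List (Subset n) → List (Subset n)
withCoord i b = filter (λ X → lookup X i ≟B b)

∈-withCoord⁺ : ∀ {n} {i : Fin n} {b L X} → X ∈ L → lookup X i ≡ b → X ∈ withCoord i b L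
∈-withCoord⁺ {i = i} {b} = ∈-filter⁺ (λ X → lookup X i ≟B b)

∈-withCoord⁻ : ∀ {n} {i : Fin n} {b L X} → X ∈ withCoord i b L → X ∈ L × lookup X i ≡ b
∈-withCoord⁻ {i = i} {b} {L} = ∈-filter⁻ (λ X → lookup X i ≟B b) {xs = L}

length-withCoord-suc : ∀ {n} (i : Fin n) b (L : List (Subset (suc n))) →
  length (withCoord (suc i) b L) ≡ length (withCoord i b (map tail L))
length-withCoord-suc i b [] = refl
length-withCoord-suc i b ((_ ∷ X) ∷ L) with lookup X i ≟B b
... | yes _ = cong suc (length-withCoord-suc i b L)
... | no _ = length-withCoord-suc i b L

sum-∣∣≡withCoord-zero+tails : ∀ {n} (L : List (Subset (suc n))) →
  sum (map ∣_∣ L) ≡ length (withCoord zero true L) + sum (map ∣_∣ (map tail L))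
sum-∣∣≡withCoord-zero+tails [] = refl
sum-∣∣≡withCoord-zero+tails ((false ∷ X) ∷ L) =
  trans (cong (∣ X ∣ +_) (sum-∣∣≡withCoord-zero+tails L))
        (x∙yz≈y∙xz ∣ X ∣ (length (withCoord zero true L)) _)
sum-∣∣≡withCoord-zero+tails ((true ∷ X) ∷ L) = cong suc
  (trans (cong (∣ X ∣ +_) (sum-∣∣≡withCoord-zero+tails L))
         (x∙yz≈y∙xz ∣ X ∣ (length (withCoord zero true L)) _))

sum-∣∣≤ : ∀ {n M} (L : List (Subset n)) → (∀ i → length (withCoord i true L) ≤ M) →
  sum (map ∣_∣ L) ≤ n * M
sum-∣∣≤ {zero} [] _ = z≤n
sum-∣∣≤ {zero} {M} ([] ∷ L) _ = sum-∣∣≤ {M = M} L λ ()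
sum-∣∣≤ {suc n} {M} L bound = begin
  sum (map ∣_∣ L)                                              ≡⟨ sum-∣∣≡withCoord-zero+tails L ⟩
  length (withCoord zero true L) + sum (map ∣_∣ (map tail L))
    ≤⟨ +-mono-≤ (bound zero) (sum-∣∣≤ (map tail L) tailBound) ⟩
  M + n * M                                                    ∎
  where
  open ≤-Reasoning
  tailBound : ∀ i → length (withCoord i true (map tail L)) ≤ M
  tailBound i = subst (_≤ M) (length-withCoord-suc i true L) (bound (suc i))

lighterSide : ∀ {n k} (i : Fin n) (F : List (Subset n)) → length F ≤ k →
  Σ Bool λ b → length (withCoord i b F) ≤ k / 2
lighterSide {k = k} i F |F|≤k =
  [ (λ ℓ₀≤ℓ₁ → false , ≤-half ℓ₀≤ℓ₁ ℓ₀+ℓ₁≤k)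
  , (λ ℓ₁≤ℓ₀ → true , ≤-half ℓ₁≤ℓ₀ (subst (_≤ k) (+-comm ℓ₀ ℓ₁) ℓ₀+ℓ₁≤k))
  ]′ (≤-total ℓ₀ ℓ₁)
  where
  ℓ₀ ℓ₁ : ℕ
  ℓ₀ = length (withCoord i false F)
  ℓ₁ = length (withCoord i true F)
  ℓ₀+ℓ₁≤k : ℓ₀ + ℓ₁ ≤ k
  ℓ₀+ℓ₁≤k = subst (_≤ k) (sym (length-filter-false+true (λ X → lookup X i) F)) |F|≤k

-- Definitionally, shatteredCount n F d = length (shatteredSets n F d).
shatteredSets : (n : ℕ) → List (Subset n) → ℕ → List (Subset n)
shatteredSets n F d = filter (λ A → (∣ A ∣ ≟ d) ×-dec shatters? F A) (allSubsets n)

∈-shatteredSets⁺ : ∀ {n} {F : List (Subset n)} {d A} → ∣ A ∣ ≡ d → Shatters F A → A ∈ shatteredSets n F d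
∈-shatteredSets⁺ {A = A} ∣A∣≡d shatters = ∈-filter⁺ _ (∈-allSubsets A) (∣A∣≡d , shatters)

∈-shatteredSets⁻ : ∀ {n} {F : List (Subset n)} {d A} → A ∈ shatteredSets n F d → ∣ A ∣ ≡ d × Shatters F A
∈-shatteredSets⁻ {n} A∈ = proj₂ (∈-filter⁻ _ {xs = allSubsets n} A∈)

Shatters⇒realises : ∀ {n} {F : List (Subset n)} {A B} → Shatters F A → B ⊆ A → Any (λ X → X ∩ A ≡ B) F
Shatters⇒realises {B = B} shatters B⊆A = All.lookup shatters (∈-allSubsets B) B⊆A

realises⇒Shatters : ∀ {n} {F : List (Subset n)} {A} →
  (∀ {B} → B ⊆ A → Any (λ X → X ∩ A ≡ B) F) → Shatters F A
realises⇒Shatters realises = All.tabulate λ _ → realises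

-- The trace {X ∖ {i} : X ∈ F, X_i = b} is listed as a sublist of allSubsets, so it is
-- duplicate-free and is one of the families over which f maximises.
trace : ∀ {n} → Fin (suc n) → Bool → List (Subset (suc n)) → List (Subset n)
trace {n} i b F = filter (λ Y → any? (λ X → ≡-dec _≟B_ (removeAt X i) Y) (withCoord i b F)) (allSubsets n)

∈-trace⁺ : ∀ {n} {F : List (Subset (suc n))} {X} i b → X ∈ F → lookup X i ≡ b → removeAt X i ∈ trace i b F
∈-trace⁺ i b X∈F Xᵢ≡b = ∈-filter⁺ _ (∈-allSubsets _) (lose (∈-withCoord⁺ X∈F Xᵢ≡b) refl)

length-trace : ∀ {n} (i : Fin (suc n)) b (F : List (Subset (suc n))) →
  length (trace i b F) ≤ length (withCoord i b F)
length-trace {n} i b F = begin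
  length (trace i b F)                                 ≤⟨ Unique⇒length-mono-⊆ unique trace⊆ ⟩
  length (map (λ X → removeAt X i) (withCoord i b F))  ≡⟨ length-map _ (withCoord i b F) ⟩
  length (withCoord i b F)                             ∎
  where
  open ≤-Reasoning
  unique : Unique (trace i b F)
  unique = Unique.filter⁺ _ (allSubsets-unique n)
  trace⊆ : trace i b F ⊆ˡ map (λ X → removeAt X i) (withCoord i b F)
  trace⊆ Y∈ = Any.map⁺ (Any.map sym (proj₂ (∈-filter⁻ _ {xs = allSubsets n} Y∈)))

shatters-trace : ∀ {n} {F : List (Subset (suc n))} {A} i b →
  Shatters F A → lookup A i ≡ true → Shatters (trace i b F) (removeAt A i)
shatters-trace {F = F} {A} i b shatters Aᵢ = realises⇒Shatters realises
  where
  realises : ∀ {B} → B ⊆ removeAt A i → Any (λ Y → Y ∩ removeAt A i ≡ B) (trace i b F)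
  realises {B} B⊆A with find (Shatters⇒realises shatters (insertAt-⊆ i b Aᵢ B⊆A))
  ... | X , X∈F , X∩A≡ = lose (∈-trace⁺ i b X∈F (lookup-∩-insertAt i b Aᵢ X∩A≡)) (begin
    removeAt X i ∩ removeAt A i  ≡⟨ sym (removeAt-zipWith _∧_ X A i) ⟩
    removeAt (X ∩ A) i           ≡⟨ cong (λ Y → removeAt Y i) X∩A≡ ⟩
    removeAt (insertAt B i b) i  ≡⟨ removeAt-insertAt B i b ⟩
    B                            ∎)
    where open ≡-Reasoning

shatteredContaining⊆ : ∀ {n} d (F : List (Subset (suc n))) i b →
  withCoord i true (shatteredSets (suc n) F (suc d)) ⊆ˡ
  map (λ B → insertAt B i true) (shatteredSets n (trace i b F) d)
shatteredContaining⊆ {n} d F i b {A} A∈ = subst (_∈ _) reinsert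
  (∈-map⁺ _ (∈-shatteredSets⁺ ∣removeAt∣≡d (shatters-trace i b shatters Aᵢ)))
  where
  A∈shattered : A ∈ shatteredSets (suc n) F (suc d)
  A∈shattered = proj₁ (∈-withCoord⁻ A∈)
  Aᵢ : lookup A i ≡ true
  Aᵢ = proj₂ (∈-withCoord⁻ {L = shatteredSets (suc n) F (suc d)} A∈)
  shatters : Shatters F A
  shatters = proj₂ (∈-shatteredSets⁻ A∈shattered)
  ∣removeAt∣≡d : ∣ removeAt A i ∣ ≡ d
  ∣removeAt∣≡d = suc-injective
    (trans (sym (∣A∣≡1+∣removeAt∣ A i Aᵢ)) (proj₁ (∈-shatteredSets⁻ A∈shattered)))
  reinsert : insertAt (removeAt A i) i true ≡ A
  reinsert = subst (λ a → insertAt (removeAt A i) i a ≡ A) Aᵢ (insertAt-removeAt A i)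

length-shatteredContaining≤ : ∀ {n} d (F : List (Subset (suc n))) i b →
  length (withCoord i true (shatteredSets (suc n) F (suc d))) ≤ shatteredCount n (trace i b F) d
length-shatteredContaining≤ {n} d F i b = begin
  length C                                  ≤⟨ Unique⇒length-mono-⊆ unique (shatteredContaining⊆ d F i b) ⟩
  length (map (λ B → insertAt B i true) S)  ≡⟨ length-map _ S ⟩
  length S                                  ∎
  where
  open ≤-Reasoning
  C : List (Subset (suc n))
  C = withCoord i true (shatteredSets (suc n) F (suc d))
  S : List (Subset n)
  S = shatteredSets n (trace i b F) d
  unique : Unique C
  unique = Unique.filter⁺ _ (Unique.filter⁺ _ (allSubsets-unique (suc n)))

shatteredCount-bound : ∀ {n k} d (F : List (Subset (suc n))) → length F ≤ k →
  suc d * shatteredCount (suc n) F (suc d) ≤ suc n * f n (k / 2) d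
shatteredCount-bound {n} {k} d F |F|≤k = begin
  suc d * length L       ≡⟨ *-comm (suc d) (length L) ⟩
  length L * suc d       ≡⟨ sym (sum-map-const ∣_∣ L (All.tabulate (proj₁ ∘ ∈-shatteredSets⁻))) ⟩
  sum (map ∣_∣ L)        ≤⟨ sum-∣∣≤ L perCoordinate ⟩
  suc n * f n (k / 2) d  ∎
  where
  open ≤-Reasoning
  L : List (Subset (suc n))
  L = shatteredSets (suc n) F (suc d)
  perCoordinate : ∀ i → length (withCoord i true L) ≤ f n (k / 2) d
  perCoordinate i with b , small ← lighterSide i F |F|≤k =
    ≤-trans (length-shatteredContaining≤ d F i b)
      (shatteredCount≤f (filter-∈-sublists _ (allSubsets n)) (≤-trans (length-trace i b F) small))

lemma2p5 : (n k d : ℕ) → 1 ≤ d → 2 ^ (d + 1) ≤ k → d + 1 ≤ n →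
    (d + 1) * f n k (d + 1) ≤ n * f (n ∸ 1) (k / 2) d
lemma2p5 zero k d _ _ d+1≤0 with () ← ≤-trans (m≤n+m 1 d) d+1≤0
lemma2p5 (suc n) k d _ _ _ rewrite +-comm d 1 =
  *-f≤ {suc n} {k} (suc d) λ F |F|≤k → shatteredCount-bound d F |F|≤k
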